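{- For each positive integer $n$ write the harmonic number $H_n=1+\frac12+\cdots+\frac1n$ in lowest terms as $H_n=c_n/d_n$ with $c_n,d_n$ positive integers and $\gcd(c_n,d_n)=1$. Then each of the following holds for infinitely many $n$: (i) $d_n>d_{n-1}$; (ii) $d_n=d_{n-1}$; (iii) $d_n<d_{n-1}$; (iv) $c_n>c_{n-1}$; (v) $c_n<c_{n-1}$. Moreover, $c_n\neq c_{n-1}$ for all $n>1$.
   Context: $c_n$ and $d_n$ denote the numerator and denominator of the reduced fraction for $H_n=\sum_{k=1}^n 1/k$. -}

module Defs where

open import Data.Nat using (ℕ; zero; suc)
open import Data.Integer using (+_; ∣_∣)
open import Data.Rational using (ℚ; 0ℚ; _+_; _/_; ↥_; ↧ₙ_)

H : ℕ → ℚ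
H zero    = 0ℚ
H (suc n) = H n + (+ 1) / suc n

-- c n, d n : numerator and denominator of H n in lowest terms
-- (ℚ in the standard library is always stored in lowest terms with positive
-- denominator; H n > 0 for n ≥ 1, so the numerator is its absolute value).
c : ℕ → ℕ
c n = ∣ ↥ H n ∣

d : ℕ → ℕ
d n = ↧ₙ H n

InfinitelyMany : (ℕ → Set) → Set
InfinitelyMany P = ∀ (N : ℕ) → Σ ℕ (λ n → N Data.Nat.≤ n × P n)
  where open import Data.Product using (Σ; _×_)

{-# OPTIONS --safe #-}

-- From H (m + 1) = H m + 1 / (m + 1) one gets c (m + 1) · d m (m + 1) = (c m (m + 1) + d m) · d (m + 1).
-- Hence m + 1 divides d m · d (m + 1), so d cannot stay bounded and rises infinitely often; when d
-- does not fall, c rises; and c (m + 1) = c m would force c (m + 1) ∣ d (m + 1), i.e. H (m + 1) ≤ 1.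
-- The falls and plateaus of d come from p-adic bookkeeping: for p^(k+1) ≤ m < 2 p^(k+1) the term
-- 1 / p^(k+1) is the only one of valuation k + 1, so d m = p^(k+1) e with c m ≡ e (mod p).
-- At m + 1 = 2·3^(N+1) the new term 1 / (2·3^(N+1)) makes the numerator 2 c m + e divisible by 3, and
-- d and c both fall; at m + 1 = 4·3^(N+1), where moreover 8 ∣ d m, the new term leaves d unchanged.
module Submission where

open import Defs
open import Data.Nat hiding (_/_)
open import Data.Nat.Properties
open import Data.Nat.Divisibility
open import Data.Nat.Coprimality as Coprime using (Coprime; coprime-divisor)
open import Data.Nat.Primality using (Prime; prime?; prime[2]; euclidsLemma; prime⇒irreducible; prime⇒nonZero; prime⇒nonTrivial)
open import Data.Nat.Induction using (<-rec)
open import Data.Nat.Tactic.RingSolver using (solve-∀)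
open import Data.Integer as ℤ using (+_)
import Data.Integer.Properties as ℤ
open import Data.Rational as ℚ using (mkℚ; ↥_; ↧_)
import Data.Rational.Properties as ℚ
import Data.Rational.Unnormalised as ℚᵘ
import Data.Rational.Unnormalised.Properties as ℚᵘ
open import Data.Product using (∃-syntax; ∃₂; _×_; _,_)
open import Data.Sum using (_⊎_; inj₁; inj₂)
open import Data.Empty using (⊥-elim)
open import Relation.Nullary using (¬_; yes; no)
open import Relation.Nullary.Decidable using (from-yes; from-no)
open import Relation.Binary.PropositionalEquality

H-nonNegative : ∀ n → ℚ.NonNegative (H n)
H-nonNegative zero    = _
H-nonNegative (suc n) =
  ℚ.nonNeg+nonNeg⇒nonNeg (H n) {{H-nonNegative n}} (+ 1 ℚ./ suc n) {{ℚ.normalize-nonNeg 1 (suc n)}}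

↥H≡c : ∀ n → ↥ H n ≡ + c n
↥H≡c n = helper (H n) (H-nonNegative n)
  where
  helper : ∀ p → ℚ.NonNegative p → ↥ p ≡ + ℤ.∣ ↥ p ∣
  helper (mkℚ (+ _) _ _) _ = refl

c-d-coprime : ∀ n → Coprime (c n) (d n)
c-d-coprime n with H n
... | mkℚ _ _ coprime = Coprime.recompute coprime

H-suc-crossℤ : ∀ m → ↥ H (suc m) ℤ.* + (d m * suc m) ≡ (↥ H m ℤ.* + suc m ℤ.+ + 1 ℤ.* + d m) ℤ.* ↧ H (suc m)
H-suc-crossℤ m = cross (H (suc m)) (H m) (ℚᵘ.≃-trans (ℚ.toℚᵘ-homo-+ (H m) (+ 1 ℚ./ suc m))
  (ℚᵘ.+-congʳ (ℚ.toℚᵘ (H m)) (ℚ.toℚᵘ-fromℚᵘ (ℚᵘ.mkℚᵘ (+ 1) m))))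
  where
  cross : ∀ p q → ℚ.toℚᵘ p ℚᵘ.≃ ℚ.toℚᵘ q ℚᵘ.+ ℚᵘ.mkℚᵘ (+ 1) m →
          ↥ p ℤ.* + (ℚ.↧ₙ q * suc m) ≡ (↥ q ℤ.* + suc m ℤ.+ + 1 ℤ.* ↧ q) ℤ.* ↧ p
  cross (mkℚ _ _ _) (mkℚ _ _ _) (ℚᵘ.*≡* eq) = eq

H-suc-cross : ∀ m → c (suc m) * (d m * suc m) ≡ c m * suc m * d (suc m) + d m * d (suc m)
H-suc-cross m = ℤ.+-injective (begin
  + (c s * (d m * s))                            ≡⟨ ℤ.pos-* (c s) (d m * s) ⟩
  + c s ℤ.* + (d m * s)                          ≡⟨ cong (ℤ._* + (d m * s)) (sym (↥H≡c s)) ⟩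
  ↥ H s ℤ.* + (d m * s)                          ≡⟨ H-suc-crossℤ m ⟩
  (↥ H m ℤ.* + s ℤ.+ + 1 ℤ.* + d m) ℤ.* + d s    ≡⟨ cong (λ z → (z ℤ.* + s ℤ.+ + 1 ℤ.* + d m) ℤ.* + d s) (↥H≡c m) ⟩
  (+ c m ℤ.* + s ℤ.+ + 1 ℤ.* + d m) ℤ.* + d s    ≡⟨ cong₂ (λ x y → (x ℤ.+ y) ℤ.* + d s) (sym (ℤ.pos-* (c m) s)) (ℤ.*-identityˡ (+ d m)) ⟩
  + (c m * s + d m) ℤ.* + d s                    ≡⟨ sym (ℤ.pos-* (c m * s + d m) (d s)) ⟩
  + ((c m * s + d m) * d s)                      ≡⟨ cong +_ (*-distribʳ-+ (d s) (c m * s) (d m)) ⟩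
  + (c m * s * d s + d m * d s)                  ∎)
  where
  open ≡-Reasoning
  s = suc m

infix 4 H[_]≃_/_

-- H m = a / b, cross-multiplied; for b = 0 it only says a = 0.
data H[_]≃_/_ (m a b : ℕ) : Set where
  cross : c m * b ≡ a * d m → H[ m ]≃ a / b

≃-cong : ∀ {m m′ a a′ b b′} → m ≡ m′ → a ≡ a′ → b ≡ b′ → H[ m ]≃ a / b → H[ m′ ]≃ a′ / b′
≃-cong refl refl refl eq = eq

≃-reduced : ∀ m {b} → d m ≡ b → H[ m ]≃ c m / b
≃-reduced m d≡b = cross (cong (c m *_) (sym d≡b))

≃-cancel : ∀ {m a b} t .{{_ : NonZero t}} → H[ m ]≃ t * a / (t * b) → H[ m ]≃ a / b
≃-cancel {m} {a} {b} t (cross eq) = cross (*-cancelˡ-≡ (c m * b) (a * d m) t (begin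
  t * (c m * b)  ≡⟨ swap t (c m) b ⟩
  c m * (t * b)  ≡⟨ eq ⟩
  t * a * d m    ≡⟨ *-assoc t a (d m) ⟩
  t * (a * d m)  ∎))
  where
  open ≡-Reasoning
  swap : ∀ x y z → x * (y * z) ≡ y * (x * z)
  swap = solve-∀

≃-suc : ∀ {m a b} → H[ m ]≃ a / b → H[ suc m ]≃ a * suc m + b / (b * suc m)
≃-suc {m} {a} {b} (cross eq) = cross (*-cancelʳ-≡ _ _ (d m) (begin
  c s * (b * s) * d m                      ≡⟨ lhs (c s) b s (d m) ⟩
  b * (c s * (d m * s))                    ≡⟨ cong (b *_) (H-suc-cross m) ⟩
  b * (c m * s * d s + d m * d s)          ≡⟨ mid b (c m) s (d s) (d m) ⟩
  c m * b * s * d s + b * d m * d s        ≡⟨ cong (λ z → z * s * d s + b * d m * d s) eq ⟩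
  a * d m * s * d s + b * d m * d s        ≡⟨ rhs a (d m) s (d s) b ⟩
  (a * s + b) * d s * d m                  ∎))
  where
  open ≡-Reasoning
  s = suc m
  lhs : ∀ x y z w → x * (y * z) * w ≡ y * (x * (w * z))
  lhs = solve-∀
  mid : ∀ x y z w v → x * (y * z * w + v * w) ≡ y * x * z * w + x * v * w
  mid = solve-∀
  rhs : ∀ x y z w v → x * y * z * w + v * y * w ≡ (x * z + v) * w * y
  rhs = solve-∀

-- The common denominator of a / (x b) + 1 / (g w) when g divides x = g u.
≃-suc-split : ∀ {m a x b} g w u → H[ m ]≃ a / (x * b) → suc m ≡ g * w → x ≡ g * u →
              H[ suc m ]≃ a * w + u * b / (x * (b * w))
≃-suc-split {m} {a} {x} {b} g w u eq m+1≡gw x≡gu =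
  ≃-cancel g {{m*n≢0⇒m≢0 g {{subst NonZero m+1≡gw _}}}}
    (≃-cong refl numerator denominator (≃-suc eq))
  where
  numerator : a * suc m + x * b ≡ g * (a * w + u * b)
  numerator = trans (cong₂ (λ y z → a * y + z * b) m+1≡gw x≡gu) (num a g w u b)
    where
    num : ∀ a g w u b → a * (g * w) + g * u * b ≡ g * (a * w + u * b)
    num = solve-∀
  denominator : x * b * suc m ≡ g * (x * (b * w))
  denominator = trans (cong (x * b *_) m+1≡gw) (den x b g w)
    where
    den : ∀ x b g w → x * b * (g * w) ≡ g * (x * (b * w))
    den = solve-∀

≃⇒d∣ : ∀ {n a b} → H[ n ]≃ a / b → d n ∣ b
≃⇒d∣ {n} {a} (cross eq) = coprime-divisor (Coprime.sym (c-d-coprime n)) (subst (d n ∣_) (sym eq) (n∣m*n a))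

≃⇒d≤ : ∀ {n a b} → 0 < b → H[ n ]≃ a / b → d n ≤ b
≃⇒d≤ {n} 0<b eq = ∣⇒≤ {{>-nonZero 0<b}} (≃⇒d∣ {n} eq)

≃⇒c≤ : ∀ {n a b} → 0 < b → H[ n ]≃ a / b → c n ≤ a
≃⇒c≤ {n} {a} {b} 0<b eq@(cross eq′) = *-cancelʳ-≤ (c n) a b {{>-nonZero 0<b}} (begin
  c n * b   ≡⟨ eq′ ⟩
  a * d n   ≤⟨ *-monoʳ-≤ a (≃⇒d≤ {n} 0<b eq) ⟩
  a * b     ∎)
  where open ≤-Reasoning

coprime-≃⇒d≡ : ∀ {n a b} → Coprime a b → H[ n ]≃ a / b → d n ≡ b
coprime-≃⇒d≡ {n} {a} {b} a⊥b eq@(cross eq′) =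
  ∣-antisym (≃⇒d∣ eq) (coprime-divisor (Coprime.sym a⊥b) (subst (b ∣_) eq′ (n∣m*n (c n))))

coprime-≃⇒∣d : ∀ {m a x b} → Coprime x a → H[ m ]≃ a / (x * b) → x ∣ d m
coprime-≃⇒∣d {m} {a} {x} {b} x⊥a (cross eq) =
  coprime-divisor x⊥a (subst (x ∣_) eq (subst (x ∣_) (swap x b (c m)) (m∣m*n (b * c m))))
  where
  swap : ∀ x y z → x * (y * z) ≡ z * (x * y)
  swap = solve-∀

H-increasing : ∀ m → c m * d (suc m) < c (suc m) * d m
H-increasing m = *-cancelʳ-< s (c m * d s) (c s * d m) (begin-strict
  c m * d s * s                    ≡⟨ swap (c m) (d s) s ⟩
  c m * s * d s                    <⟨ m<m+n (c m * s * d s) (m*n>0 (d m) (d s)) ⟩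
  c m * s * d s + d m * d s        ≡⟨ sym (H-suc-cross m) ⟩
  c s * (d m * s)                  ≡⟨ sym (*-assoc (c s) (d m) s) ⟩
  c s * d m * s                    ∎)
  where
  open ≤-Reasoning
  s = suc m
  swap : ∀ x y z → x * y * z ≡ x * z * y
  swap = solve-∀
  m*n>0 : ∀ m n .{{_ : NonZero m}} .{{_ : NonZero n}} → 0 < m * n
  m*n>0 m n = >-nonZero⁻¹ (m * n) {{m*n≢0 m n}}

c<c-suc : ∀ m → d m ≤ d (suc m) → c m < c (suc m)
c<c-suc m d≤d′ = *-cancelʳ-< (d m) (c m) (c (suc m)) (begin-strict
  c m * d m          ≤⟨ *-monoʳ-≤ (c m) d≤d′ ⟩
  c m * d (suc m)    <⟨ H-increasing m ⟩
  c (suc m) * d m    ∎)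
  where open ≤-Reasoning

d<c-suc : ∀ m → d m ≤ c m → d (suc m) < c (suc m)
d<c-suc m d≤c = *-cancelʳ-< (d m) (d (suc m)) (c (suc m)) (begin-strict
  d (suc m) * d m    ≤⟨ *-monoʳ-≤ (d (suc m)) d≤c ⟩
  d (suc m) * c m    ≡⟨ *-comm (d (suc m)) (c m) ⟩
  c m * d (suc m)    <⟨ H-increasing m ⟩
  c (suc m) * d m    ∎)
  where open ≤-Reasoning

d≤c : ∀ m → 0 < m → d m ≤ c m
d≤c (suc zero)    _ = ≤-refl
d≤c (suc (suc m)) _ = <⇒≤ (d<c-suc (suc m) (d≤c (suc m) z<s))

c-suc≢c : ∀ m → 0 < m → c (suc m) ≢ c m
c-suc≢c (suc m) _ c′≡c = <⇒≱ (d<c-suc (suc m) (d≤c (suc m) z<s)) (begin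
  c s          ≡⟨ c′≡1 ⟩
  1            ≤⟨ >-nonZero⁻¹ (d s) ⟩
  d s          ∎)
  where
  open ≤-Reasoning
  s = suc (suc m)
  c∣d*d′ : c (suc m) ∣ d (suc m) * d s
  c∣d*d′ = ∣m+n∣m⇒∣n (subst (c (suc m) ∣_) (H-suc-cross (suc m)) (subst (_∣ c s * (d (suc m) * s)) c′≡c (m∣m*n (d (suc m) * s))))
                     (∣m⇒∣m*n (d s) (m∣m*n s))
  c′∣d′ : c s ∣ d s
  c′∣d′ = subst (_∣ d s) (sym c′≡c) (coprime-divisor (c-d-coprime (suc m)) c∣d*d′)
  c′≡1 : c s ≡ 1
  c′≡1 = c-d-coprime s (∣-refl , c′∣d′)

suc∣d*d-suc : ∀ m → suc m ∣ d m * d (suc m)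
suc∣d*d-suc m = ∣m+n∣m⇒∣n (subst (suc m ∣_) (H-suc-cross m) (∣n⇒∣m*n (c (suc m)) (n∣m*n (d m))))
                         (∣m⇒∣m*n (d (suc m)) (n∣m*n (c m)))

rise-or-below : ∀ (f : ℕ → ℕ) a k → (∃[ n ] a ≤ n × f n < f (suc n)) ⊎ f (a + k) ≤ f a
rise-or-below f a zero = inj₂ (≤-reflexive (cong f (+-identityʳ a)))
rise-or-below f a (suc k) with rise-or-below f a k
... | inj₁ rise = inj₁ rise
... | inj₂ below with f (a + k) <? f (suc (a + k))
...   | yes rise = inj₁ (a + k , m≤m+n a k , rise)
...   | no ¬rise = inj₂ (subst (λ n → f n ≤ f a) (sym (+-suc a k)) (≤-trans (≮⇒≥ ¬rise) below))

-- Staying below f a from a onwards would bound m + 1 ≤ f m * f (m + 1) by f a * f a.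
rises-beyond : ∀ (f : ℕ → ℕ) → (∀ m → suc m ≤ f m * f (suc m)) → ∀ a → ∃[ n ] a ≤ n × f n < f (suc n)
rises-beyond f grows a with rise-or-below f a k | rise-or-below f a (suc k)
  where k = f a * f a
... | inj₁ rise | _          = rise
... | inj₂ _    | inj₁ rise  = rise
... | inj₂ below | inj₂ below′ = ⊥-elim (<⇒≱ (s≤s (m≤n+m k a)) (begin
  suc (a + k)                  ≤⟨ grows (a + k) ⟩
  f (a + k) * f (suc (a + k))  ≤⟨ *-mono-≤ below (subst (λ n → f n ≤ f a) (+-suc a k) below′) ⟩
  f a * f a                    ∎))
  where
  open ≤-Reasoning
  k = f a * f a

pred[n]<n : ∀ n .{{_ : NonZero n}} → pred n < n
pred[n]<n (suc n) = n<1+n n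

prime∤⇒coprime : ∀ {p n} → Prime p → ¬ p ∣ n → Coprime p n
prime∤⇒coprime p-prime p∤n (i∣p , i∣n) with prime⇒irreducible p-prime i∣p
... | inj₁ i≡1 = i≡1
... | inj₂ refl = ⊥-elim (p∤n i∣n)

coprime-* : ∀ {a b n} → Coprime a n → Coprime b n → Coprime (a * b) n
coprime-* {a} {n = n} a⊥n b⊥n {i} (i∣ab , i∣n) = b⊥n (coprime-divisor i⊥a i∣ab , i∣n)
  where
  i⊥a : Coprime i a
  i⊥a (j∣i , j∣a) = a⊥n (j∣a , ∣-trans j∣i i∣n)

prime∤⇒coprime-^ : ∀ {p n} → Prime p → ¬ p ∣ n → ∀ k → Coprime (p ^ k) n
prime∤⇒coprime-^ _       _   zero    = Coprime.1-coprimeTo _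
prime∤⇒coprime-^ p-prime p∤n (suc k) = coprime-* (prime∤⇒coprime p-prime p∤n) (prime∤⇒coprime-^ p-prime p∤n k)

module PAdic (p : ℕ) (p-prime : Prime p) where

  instance
    p≢0 : NonZero p
    p≢0 = prime⇒nonZero p-prime

  p∤1 : ¬ p ∣ 1
  p∤1 p∣1 = nonTrivial⇒≢1 {{prime⇒nonTrivial p-prime}} (∣1⇒≡1 p∣1)

  p∤* : ∀ {a b} → ¬ p ∣ a → ¬ p ∣ b → ¬ p ∣ a * b
  p∤* {a} {b} p∤a p∤b p∣ab with euclidsLemma a b p-prime p∣ab
  ... | inj₁ p∣a = p∤a p∣a
  ... | inj₂ p∣b = p∤b p∣b

  ^-split : ∀ {v k} → v ≤ k → p ^ k ≡ p ^ v * p ^ (k ∸ v)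
  ^-split {v} {k} v≤k = trans (cong (p ^_) (sym (m+[n∸m]≡n v≤k))) (^-distribˡ-+-* p v (k ∸ v))

  p-split : ∀ i → 0 < i → ∃₂ λ v w → i ≡ p ^ v * w × ¬ p ∣ w
  p-split = <-rec _ split
    where
    split : ∀ i → (∀ {j} → j < i → 0 < j → ∃₂ λ v w → j ≡ p ^ v * w × ¬ p ∣ w) →
            0 < i → ∃₂ λ v w → i ≡ p ^ v * w × ¬ p ∣ w
    split i rec 0<i with p ∣? i
    ... | no p∤i = 0 , i , sym (*-identityˡ i) , p∤i
    ... | yes (divides (suc q) i≡q*p) with rec (subst (suc q <_) (sym i≡q*p) q<q*p) z<s
      where q<q*p = m<m*n (suc q) p (nonTrivial⇒n>1 p {{prime⇒nonTrivial p-prime}})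
    ...   | v , w , q≡ , p∤w = suc v , w , trans i≡q*p (trans (cong (_* p) q≡) (swap (p ^ v) w p)) , p∤w
      where
      swap : ∀ x y z → x * y * z ≡ z * x * y
      swap = solve-∀
    split i rec 0<i | yes (divides zero i≡0) = ⊥-elim (<⇒≢ 0<i (sym i≡0))

  ≤-valuation : ∀ {i v w k} → i ≡ p ^ v * w → ¬ p ^ suc k ∣ i → v ≤ k
  ≤-valuation {i} {v} {w} {k} i≡ p^k+1∤i with v ≤? k
  ... | yes v≤k = v≤k
  ... | no v≰k = ⊥-elim (p^k+1∤i (subst (p ^ suc k ∣_) (sym i≡) (∣m⇒∣m*n w p^k+1∣p^v)))
    where
    p^k+1∣p^v : p ^ suc k ∣ p ^ v
    p^k+1∣p^v = subst (p ^ suc k ∣_) (sym (^-split (≰⇒> v≰k))) (m∣m*n _)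

  H-below : ∀ k m → m < p ^ suc k → ∃₂ λ a b → ¬ p ∣ b × H[ m ]≃ a / (p ^ k * b)
  H-below k zero    _ = 0 , 1 , p∤1 , cross refl
  H-below k (suc m) m+1<P with H-below k m (<-trans (n<1+n m) m+1<P) | p-split (suc m) z<s
  ... | a , b , p∤b , eq | v , w , m+1≡ , p∤w =
    a * w + p ^ (k ∸ v) * b , b * w , p∤* p∤b p∤w , ≃-suc-split (p ^ v) w (p ^ (k ∸ v)) eq m+1≡ (^-split v≤k)
    where
    v≤k : v ≤ k
    v≤k = ≤-valuation m+1≡ (λ P∣m+1 → <⇒≱ m+1<P (∣⇒≤ P∣m+1))

  -- Between p^(k+1) and 2 p^(k+1) the only index of valuation k+1 is p^(k+1) itself, whose
  -- term 1 / p^(k+1) contributes the numerator b modulo p.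
  H-above : ∀ k j → j < p ^ suc k → ∃₂ λ a b → ¬ p ∣ b × H[ p ^ suc k + j ]≃ b + p * a / (p ^ suc k * b)
  H-above k zero _ with H-below k (pred P) (pred[n]<n P {{m^n≢0 p (suc k)}})
    where P = p ^ suc k
  ... | a , b , p∤b , eq = a , b , p∤b ,
    ≃-cancel (p ^ k) {{m^n≢0 p k}} (≃-cong P≡P+0 (numerator a p (p ^ k) b) (denominator (p ^ k) b p)
      (subst (λ n → H[ n ]≃ a * n + p ^ k * b / (p ^ k * b * n)) (suc-pred P {{m^n≢0 p (suc k)}}) (≃-suc eq)))
    where
    P = p ^ suc k
    P≡P+0 = sym (+-identityʳ P)
    numerator : ∀ a p x b → a * (p * x) + x * b ≡ x * (b + p * a)
    numerator = solve-∀
    denominator : ∀ x b p → x * b * (p * x) ≡ x * (p * x * b)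
    denominator = solve-∀
  H-above k (suc j) j+1<P with H-above k j (<-trans (n<1+n j) j+1<P) | p-split (suc (p ^ suc k + j)) z<s
  ... | a , b , p∤b , eq | v , w , i≡ , p∤w =
    a * w + p ^ (k ∸ v) * b , b * w , p∤* p∤b p∤w ,
    ≃-cong (sym (+-suc P j)) (numerator b p a w (p ^ (k ∸ v))) refl (≃-suc-split (p ^ v) w (p * p ^ (k ∸ v)) eq i≡ P≡p^v*p*p^[k-v])
    where
    P = p ^ suc k
    v≤k : v ≤ k
    v≤k = ≤-valuation i≡ (λ P∣i → <⇒≱ j+1<P (∣⇒≤ (∣m+n∣m⇒∣n (subst (P ∣_) (sym (+-suc P j)) P∣i) ∣-refl)))
    P≡p^v*p*p^[k-v] : P ≡ p ^ v * (p * p ^ (k ∸ v))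
    P≡p^v*p*p^[k-v] = trans (cong (p *_) (^-split v≤k)) (swap p (p ^ v) (p ^ (k ∸ v)))
      where
      swap : ∀ x y z → x * (y * z) ≡ y * (x * z)
      swap = solve-∀
    numerator : ∀ b p a w u → (b + p * a) * w + p * u * b ≡ b * w + p * (a * w + u * b)
    numerator = solve-∀

  ≃-above⇒∣d : ∀ {m K a b} → ¬ p ∣ b → H[ m ]≃ b + p * a / (p ^ K * b) → p ^ K ∣ d m
  ≃-above⇒∣d {K = K} {a} {b} p∤b = coprime-≃⇒∣d (prime∤⇒coprime-^ p-prime p∤b+pa K)
    where
    p∤b+pa : ¬ p ∣ b + p * a
    p∤b+pa p∣b+pa = p∤b (∣m+n∣m⇒∣n (subst (p ∣_) (+-comm b (p * a)) p∣b+pa) (m∣m*n a))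

  -- c m ≡ e (mod p), stated without congruences.
  ≃-above⇒residue : ∀ {m K a b e} x y → ¬ p ∣ b → H[ m ]≃ b + p * a / (p ^ K * b) →
                    d m ≡ p ^ K * e → p ∣ x + y → p ∣ x * c m + y * e
  ≃-above⇒residue {m} {K} {a} {b} {e} x y p∤b (cross eq) d≡ p∣x+y with euclidsLemma _ b p-prime p∣[xc+ye]b
    where
    cb≡ : c m * b ≡ (b + p * a) * e
    cb≡ = *-cancelˡ-≡ _ _ (p ^ K) {{m^n≢0 p K}} (begin
      p ^ K * (c m * b)           ≡⟨ swap (p ^ K) (c m) b ⟩
      c m * (p ^ K * b)           ≡⟨ eq ⟩
      (b + p * a) * d m           ≡⟨ cong ((b + p * a) *_) d≡ ⟩
      (b + p * a) * (p ^ K * e)   ≡⟨ swap (b + p * a) (p ^ K) e ⟩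
      p ^ K * ((b + p * a) * e)   ∎)
      where
      open ≡-Reasoning
      swap : ∀ x y z → x * (y * z) ≡ y * (x * z)
      swap = solve-∀
    p∣[xc+ye]b : p ∣ (x * c m + y * e) * b
    p∣[xc+ye]b = subst (p ∣_) (sym (begin
      (x * c m + y * e) * b             ≡⟨ distrib x (c m) y e b ⟩
      x * (c m * b) + y * e * b         ≡⟨ cong (λ z → x * z + y * e * b) cb≡ ⟩
      x * ((b + p * a) * e) + y * e * b ≡⟨ regroup x b p a e y ⟩
      (x + y) * (b * e) + p * (x * a * e) ∎))
      (∣m∣n⇒∣m+n (∣m⇒∣m*n (b * e) p∣x+y) (m∣m*n (x * a * e)))
      where
      open ≡-Reasoning
      distrib : ∀ x c y e b → (x * c + y * e) * b ≡ x * (c * b) + y * e * b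
      distrib = solve-∀
      regroup : ∀ x b p a e y → x * ((b + p * a) * e) + y * e * b ≡ (x + y) * (b * e) + p * (x * a * e)
      regroup = solve-∀
  ... | inj₁ p∣xc+ye = p∣xc+ye
  ... | inj₂ p∣b     = ⊥-elim (p∤b p∣b)

  ^∣d-above : ∀ k j → j < p ^ suc k → p ^ suc k ∣ d (p ^ suc k + j)
  ^∣d-above k j j<P = let a , b , p∤b , eq = H-above k j j<P in ≃-above⇒∣d {K = suc k} {a} {b} p∤b eq

  d-above : ∀ k j → j < p ^ suc k → ∃[ e ] d (p ^ suc k + j) ≡ p ^ suc k * e ×
            (∀ x y → p ∣ x + y → p ∣ x * c (p ^ suc k + j) + y * e)
  d-above k j j<P with H-above k j j<P
  ... | a , b , p∤b , eq with ≃-above⇒∣d {K = suc k} {a} {b} p∤b eq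
  ...   | divides e d≡e*P = e , d≡ , λ x y → ≃-above⇒residue {K = suc k} {a} {b} {e} x y p∤b eq d≡
    where
    d≡ = trans d≡e*P (*-comm e (p ^ suc k))

module Two   = PAdic 2 prime[2]
module Three = PAdic 3 (from-yes (prime? 3))

binary-split : ∀ m → 0 < m → ∃₂ λ J j → m ≡ 2 ^ J + j × j < 2 ^ J
binary-split (suc zero)    _ = 0 , 0 , refl , z<s
binary-split (suc (suc m)) _ with binary-split (suc m) z<s
... | J , j , m+1≡ , j<2^J with suc j <? 2 ^ J
...   | yes j+1<2^J = J , suc j , trans (cong suc m+1≡) (sym (+-suc (2 ^ J) j)) , j+1<2^J
...   | no  j+1≮2^J = suc J , 0 , (begin
  suc (suc m)          ≡⟨ cong suc m+1≡ ⟩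
  suc (2 ^ J + j)      ≡⟨ sym (+-suc (2 ^ J) j) ⟩
  2 ^ J + suc j        ≡⟨ cong (λ x → 2 ^ J + x) (≤-antisym j<2^J (≮⇒≥ j+1≮2^J)) ⟩
  2 ^ J + 2 ^ J        ≡⟨ cong (λ x → 2 ^ J + x) (sym (+-identityʳ (2 ^ J))) ⟩
  2 ^ suc J            ≡⟨ sym (+-identityʳ (2 ^ suc J)) ⟩
  2 ^ suc J + 0        ∎) , m^n>0 2 (suc J)
  where open ≡-Reasoning

8∣d : ∀ m → 8 ≤ m → 8 ∣ d m
8∣d m 8≤m with binary-split m (≤-trans (s≤s z≤n) 8≤m)
... | J , j , m≡ , j<2^J = split J j m≡ j<2^J
  where
  split : ∀ J j → m ≡ 2 ^ J + j → j < 2 ^ J → 8 ∣ d m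
  split zero                j m≡ j<2^J = ⊥-elim (<⇒≱ (subst (_< 2) (sym m≡) (+-monoʳ-< 1 j<2^J)) (≤-trans (m≤m+n 2 6) 8≤m))
  split (suc zero)          j m≡ j<2^J = ⊥-elim (<⇒≱ (subst (_< 4) (sym m≡) (+-monoʳ-< 2 j<2^J)) (≤-trans (m≤m+n 4 4) 8≤m))
  split (suc (suc zero))    j m≡ j<2^J = ⊥-elim (<⇒≱ (subst (_< 8) (sym m≡) (+-monoʳ-< 4 j<2^J)) 8≤m)
  split (suc (suc (suc J))) j m≡ j<2^J =
    ∣-trans 8∣2^J+3 (subst (λ n → 2 ^ (3 + J) ∣ d n) (sym m≡) (Two.^∣d-above (2 + J) j j<2^J))
    where
    8∣2^J+3 : 8 ∣ 2 ^ (3 + J)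
    8∣2^J+3 = subst (8 ∣_) (sym (^-distribˡ-+-* 2 3 J)) (m∣m*n (2 ^ J))

n≤3^n : ∀ n → n ≤ 3 ^ n
n≤3^n zero    = z≤n
n≤3^n (suc n) = begin
  suc n                    ≤⟨ s≤s (n≤3^n n) ⟩
  suc (3 ^ n)              ≡⟨ +-comm 1 (3 ^ n) ⟩
  3 ^ n + 1                ≤⟨ +-monoʳ-≤ (3 ^ n) (≤-trans (m^n>0 3 n) (m≤m+n (3 ^ n) (3 ^ n + 0))) ⟩
  3 ^ suc n                ∎
  where open ≤-Reasoning

-- H (m + 1) = (2 c m + e) / (2 · 3X e) = ((2 c m + e) / 3) / (2 X e).
drop-by-3 : ∀ {m X e} → 0 < m → d m ≡ 3 * X * e → suc m ≡ 3 * X * 2 → 3 ∣ 2 * c m + 1 * e →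
            d (suc m) < d m × c (suc m) < c m
drop-by-3 {m} {X} {e} 0<m d≡ m+1≡ (divides F 2c+e≡F*3) = d′<d , c′<c
  where
  instance
    Xe≢0 : NonZero (X * e)
    Xe≢0 = m*n≢0⇒n≢0 3 {{subst NonZero (*-assoc 3 X e) (subst NonZero d≡ _)}}
    X≢0 : NonZero X
    X≢0 = m*n≢0⇒m≢0 X
    e≢0 : NonZero e
    e≢0 = m*n≢0⇒n≢0 X
  0<X[e2] : 0 < X * (e * 2)
  0<X[e2] = >-nonZero⁻¹ (X * (e * 2)) {{m*n≢0 X (e * 2) {{X≢0}} {{m*n≢0 e 2}}}}
  d≡′ : d m ≡ X * (e * 2) + X * e
  d≡′ = trans d≡ (split X e)
    where
    split : ∀ X e → 3 * X * e ≡ X * (e * 2) + X * e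
    split = solve-∀
  eq : H[ suc m ]≃ F / (X * (e * 2))
  eq = ≃-cancel 3 (≃-cong refl numerator (*-assoc 3 X (e * 2))
         (≃-suc-split (3 * X) 2 1 (≃-reduced m d≡) m+1≡ (sym (*-identityʳ (3 * X)))))
    where
    numerator : c m * 2 + 1 * e ≡ 3 * F
    numerator = trans (cong (_+ 1 * e) (*-comm (c m) 2)) (trans 2c+e≡F*3 (*-comm F 3))
  d′<d : d (suc m) < d m
  d′<d = begin-strict
    d (suc m)               ≤⟨ ≃⇒d≤ 0<X[e2] eq ⟩
    X * (e * 2)             <⟨ m<m+n (X * (e * 2)) (>-nonZero⁻¹ (X * e)) ⟩
    X * (e * 2) + X * e     ≡⟨ sym d≡′ ⟩
    d m                     ∎
    where open ≤-Reasoning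
  e<c : e < c m
  e<c = begin-strict
    e                       ≤⟨ m≤n*m e X ⟩
    X * e                   <⟨ m<n+m (X * e) 0<X[e2] ⟩
    X * (e * 2) + X * e     ≡⟨ sym d≡′ ⟩
    d m                     ≤⟨ d≤c m 0<m ⟩
    c m                     ∎
    where open ≤-Reasoning
  c′<c : c (suc m) < c m
  c′<c = ≤-<-trans (≃⇒c≤ 0<X[e2] eq) (*-cancelʳ-< 3 F (c m) (begin-strict
    F * 3                   ≡⟨ sym 2c+e≡F*3 ⟩
    2 * c m + 1 * e         ≡⟨ cong (λ z → 2 * c m + z) (*-identityˡ e) ⟩
    2 * c m + e             <⟨ +-monoʳ-< (2 * c m) e<c ⟩
    2 * c m + c m           ≡⟨ triple (c m) ⟩
    c m * 3                 ∎))
    where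
    open ≤-Reasoning
    triple : ∀ x → 2 * x + x ≡ x * 3
    triple = solve-∀

d-suc≡d : ∀ {m g} → d m ≡ suc m * g → Coprime (c m + g) (d m) → d (suc m) ≡ d m
d-suc≡d {m} {g} d≡ coprime = coprime-≃⇒d≡ coprime
  (≃-cong refl (cong₂ _+_ (*-identityʳ (c m)) (*-identityˡ g)) (trans (cong (suc m *_) (*-identityʳ g)) (sym d≡))
    (≃-suc-split (suc m) 1 1 (≃-reduced m d≡) (sym (*-identityʳ (suc m))) (sym (*-identityʳ (suc m)))))

-- Every prime factor of d m = 3^(K+1) · 8 f divides 6 f, so adding 6 f keeps c m coprime to d m.
coprime-c+6f : ∀ {m K f} → d m ≡ 3 ^ suc K * (f * 8) → Coprime (c m + 6 * f) (d m)
coprime-c+6f {m} {K} {f} d≡ = subst (Coprime (c m + 6 * f)) (sym d≡)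
  (Coprime.sym (coprime-* (prime∤⇒coprime-^ prime[3] 3∤X (suc K)) (coprime-* f⊥X (prime∤⇒coprime-^ prime[2] 2∤X 3))))
  where
  prime[3] = from-yes (prime? 3)
  X = c m + 6 * f
  ∣d : ∀ {i} → i ∣ 3 ^ suc K * (f * 8) → i ∣ d m
  ∣d {i} = subst (i ∣_) (sym d≡)
  trivial : ∀ {i} → i ∣ X → i ∣ 6 * f → i ∣ d m → i ≡ 1
  trivial {i} i∣X i∣6f i∣d = c-d-coprime m (∣m+n∣m⇒∣n (subst (i ∣_) (+-comm (c m) (6 * f)) i∣X) i∣6f , i∣d)
  3∤X : ¬ 3 ∣ X
  3∤X 3∣X with trivial 3∣X (∣m⇒∣m*n f (divides 2 refl)) (∣d (∣m⇒∣m*n (f * 8) (m∣m*n (3 ^ K))))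
  ... | ()
  2∤X : ¬ 2 ∣ X
  2∤X 2∣X with trivial 2∣X (∣m⇒∣m*n f (divides 3 refl)) (∣d (∣n⇒∣m*n (3 ^ suc K) (∣n⇒∣m*n f (divides 4 refl))))
  ... | ()
  f⊥X : Coprime f X
  f⊥X (i∣f , i∣X) = trivial i∣X (∣n⇒∣m*n 6 i∣f) (∣d (∣n⇒∣m*n (3 ^ suc K) (∣m⇒∣m*n 8 i∣f)))

drops : ∀ N → ∃[ m ] N ≤ m × 0 < m × (d (suc m) < d m × c (suc m) < c m)
drops N = let e , d≡ , residue = Three.d-above N (pred T) (pred[n]<n T) in
  m , N≤m , 0<m , drop-by-3 {X = 3 ^ N} 0<m d≡ m+1≡ (residue 2 1 ∣-refl)
  where
  T = 3 ^ suc N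
  instance
    T≢0 : NonZero T
    T≢0 = m^n≢0 3 (suc N)
  m = T + pred T
  0<m : 0 < m
  0<m = ≤-trans (>-nonZero⁻¹ T) (m≤m+n T (pred T))
  N≤m : N ≤ m
  N≤m = ≤-trans (n≤3^n N) (≤-trans (^-monoʳ-≤ 3 (n≤1+n N)) (m≤m+n T (pred T)))
  m+1≡ : suc m ≡ T * 2
  m+1≡ = trans (sym (+-suc T (pred T))) (trans (cong (λ x → T + x) (suc-pred T)) (double T))
    where
    double : ∀ x → x + x ≡ x * 2
    double = solve-∀

stalls : ∀ N → ∃[ m ] N ≤ m × 0 < m × d (suc m) ≡ d m
stalls N = m , N≤m , 0<m , stall
  where
  T = 3 ^ suc N
  instance
    T≢0 : NonZero T
    T≢0 = m^n≢0 3 (suc N)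
  U = 3 ^ suc (suc N)
  m = U + pred T
  0<m : 0 < m
  0<m = ≤-trans (>-nonZero⁻¹ U {{m^n≢0 3 (suc (suc N))}}) (m≤m+n U (pred T))
  N≤m : N ≤ m
  N≤m = ≤-trans (n≤3^n N) (≤-trans (^-monoʳ-≤ 3 (≤-trans (n≤1+n N) (n≤1+n (suc N)))) (m≤m+n U (pred T)))
  8≤m : 8 ≤ m
  8≤m = ≤-trans (n≤1+n 8) (≤-trans (^-monoʳ-≤ 3 {2} {suc (suc N)} (s≤s (s≤s z≤n))) (m≤m+n U (pred T)))
  m+1≡ : suc m ≡ 3 * T + T
  m+1≡ = trans (sym (+-suc U (pred T))) (cong (λ x → U + x) (suc-pred T))
  8⊥U : Coprime 8 U
  8⊥U = Coprime.sym (prime∤⇒coprime-^ (from-yes (prime? 3)) (from-no (3 ∣? 8)) (suc (suc N)))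
  stall : d (suc m) ≡ d m
  stall with Three.d-above (suc N) (pred T) (<-≤-trans (pred[n]<n T) (m≤m+n T (T + (T + 0))))
  ... | e , d≡ , _ with coprime-divisor 8⊥U (subst (8 ∣_) d≡ (8∣d m 8≤m))
  ... | divides f e≡f*8 = d-suc≡d {m} d≡[m+1]*6f (coprime-c+6f {m} {suc N} {f} d≡U*8f)
    where
    d≡U*8f : d m ≡ U * (f * 8)
    d≡U*8f = trans d≡ (cong (U *_) e≡f*8)
    d≡[m+1]*6f : d m ≡ suc m * (6 * f)
    d≡[m+1]*6f = trans d≡U*8f (trans (regroup T f) (cong (_* (6 * f)) (sym m+1≡)))
      where
      regroup : ∀ T f → 3 * T * (f * 8) ≡ (3 * T + T) * (6 * f)
      regroup = solve-∀

d-rises : ∀ N → ∃[ m ] N ≤ m × 0 < m × d (suc m) > d m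
d-rises N = let m , N<m , rise = rises-beyond d grows (suc N) in m , <⇒≤ N<m , <-≤-trans z<s N<m , rise
  where
  grows : ∀ m → suc m ≤ d m * d (suc m)
  grows m = ∣⇒≤ (suc∣d*d-suc m)

c-rises : ∀ N → ∃[ m ] N ≤ m × 0 < m × c (suc m) > c m
c-rises N = let m , N≤m , 0<m , rise = d-rises N in m , N≤m , 0<m , c<c-suc m (<⇒≤ rise)

consecutive : ∀ (R : ℕ → ℕ → Set) → (∀ N → ∃[ m ] N ≤ m × 0 < m × R (suc m) m) →
              InfinitelyMany (λ n → 1 < n × R n (n ∸ 1))
consecutive R often N = let m , N≤m , 0<m , r = often N in suc m , m≤n⇒m≤1+n N≤m , s≤s 0<m , r

theorem1 : InfinitelyMany (λ n → 1 < n × d n > d (n ∸ 1))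
    × InfinitelyMany (λ n → 1 < n × d n ≡ d (n ∸ 1))
    × InfinitelyMany (λ n → 1 < n × d n < d (n ∸ 1))
    × InfinitelyMany (λ n → 1 < n × c n > c (n ∸ 1))
    × InfinitelyMany (λ n → 1 < n × c n < c (n ∸ 1))
    × (∀ (n : ℕ) → 1 < n → c n ≢ c (n ∸ 1))
theorem1 =
  consecutive (λ n n′ → d n > d n′) d-rises ,
  consecutive (λ n n′ → d n ≡ d n′) stalls ,
  consecutive (λ n n′ → d n < d n′) (λ N → let m , N≤m , 0<m , d< , _ = drops N in m , N≤m , 0<m , d<) ,
  consecutive (λ n n′ → c n > c n′) c-rises ,
  consecutive (λ n n′ → c n < c n′) (λ N → let m , N≤m , 0<m , _ , c< = drops N in m , N≤m , 0<m , c<) ,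
  λ { (suc (suc m)) _ → c-suc≢c (suc m) z<s }
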